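{- For every H-tree and every pre-Q-tree, the construction of paths (regular paths, the root path, and special paths) is well-defined; that is, whenever the construction requires taking the rightmost, resp. leftmost, non-positive child edge of an internal vertex, such an edge exists.
   Context: A rooted binary plane tree $T$ has a root $v_0$ of degree 1; every other vertex is a leaf (degree 1) or internal (degree 3, with parent edge $v^-$ and ordered left/right child edges $v^{\mathrm L},v^{\mathrm R}$). $V_I(T)$ is the set of internal vertices, $e_0$ the edge at $v_0$. A partition tree of degree $n$ and base-length $p$ is $(T,v_0,f_V,f_E)$ with $T$ having $n$ leaves, $f_V:V_I(T)\to\mathbb{Z}_{\ge0}$, $f_E:E(T)\to\mathbb{Z}$, $f_V(v)=f_E(v^{\mathrm L})+f_E(v^{\mathrm R})-f_E(v^-)+1$ for all internal $v$, and $f_E(e_0)=p$. An edge $e$ is positive if $f_E(e)>0$. An internal vertex $v$ is a bottom vertex if $\mathbf{1}_{f_E(v^-)\le0}<\mathbf{1}_{f_E(v^{\mathrm L})\le0}+\mathbf{1}_{f_E(v^{\mathrm R})\le0}$, otherwise a top vertex. An H-tree is a partition tree with $n\ge1$ such that $f_E(e)=0$ iff $e$ is incident to a leaf, and $f_V(v)=0$ for every top vertex. A pre-Q-tree is a partition tree with $n\ge1$ such that $f_E(e)\le0$ for every edge incident to a leaf and $f_V\equiv0$. Paths: (1) for each bottom vertex $v$, the regular path starts with the rightmost non-positive child edge of $v$ and then repeatedly continues with the leftmost non-positive child edge of the lower endpoint of the current edge, until a leaf is reached; (2) if $p\le0$, the root path starts with $e_0$ and then continues by the same rule; (3) for each bottom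 vertex $v$ with positive parent edge and two non-positive child edges, the special path starts with the left child edge $v^{\mathrm L}$ and then continues by the same rule. -}

module Defs where

open import Data.Nat using (ℕ; zero; suc) renaming (_<_ to _<ℕ_; _+_ to _+ℕ_)
open import Data.Integer using (ℤ; +_; _+_; _-_; _≤_; _>_; _≤?_; 0ℤ; 1ℤ)
open import Data.Bool using (Bool; true; false; if_then_else_)
open import Data.Maybe using (Maybe; just; nothing)
open import Data.Product using (_×_; Σ-syntax)
open import Data.Unit using (⊤)
open import Data.Empty using (⊥)
open import Relation.Nullary using (¬_; does)
open import Relation.Binary.PropositionalEquality using (_≡_)

-- A rooted binary plane tree T with root v₀ of degree 1, carrying the
-- labels f_E and f_V, is represented by the subtree hanging from the root
-- edge e₀.  Each subtree is identified with the edge above its top vertex: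
--   leaf e          : an edge with label e whose lower endpoint is a leaf
--   node e v l r    : an edge with label e whose lower endpoint is an
--                     internal vertex with f_V = v, left subtree l (whose
--                     top edge is the left child edge) and right subtree r.
data LTree : Set where
  leaf : ℤ → LTree
  node : ℤ → ℕ → LTree → LTree → LTree

label : LTree → ℤ
label (leaf e)       = e
label (node e _ _ _) = e

baseLength : LTree → ℤ
baseLength = label

-- s ≼ t : s is a subtree of t (i.e. the top vertex of s is a vertex of t)
data _≼_ : LTree → LTree → Set where
  here : ∀ {t} → t ≼ t
  inL  : ∀ {s e v l r} → s ≼ l → s ≼ node e v l r
  inR  : ∀ {s e v l r} → s ≼ r → s ≼ node e v l r

AllNodes : (ℤ → ℕ → LTree → LTree → Set) → LTree → Set
AllNodes Q (leaf _)       = ⊤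
AllNodes Q (node e v l r) = Q e v l r × AllNodes Q l × AllNodes Q r

AllLeafEdges : (ℤ → Set) → LTree → Set
AllLeafEdges Q (leaf e)       = Q e
AllLeafEdges Q (node _ _ l r) = AllLeafEdges Q l × AllLeafEdges Q r

-- partition tree: f_V(v) = f_E(v^L) + f_E(v^R) - f_E(v^-) + 1
PartitionTree : LTree → Set
PartitionTree = AllNodes (λ e v l r → + v ≡ label l + label r - e + 1ℤ)

nonPos : ℤ → Bool
nonPos x = does (x ≤? 0ℤ)

ind : ℤ → ℕ
ind x = if nonPos x then 1 else 0

BottomData : ℤ → LTree → LTree → Set
BottomData e l r = ind e <ℕ ind (label l) +ℕ ind (label r)

Bottom : LTree → Set
Bottom (leaf _)       = ⊥
Bottom (node e _ l r) = BottomData e l r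

IsHTree : LTree → Set
IsHTree t =
  PartitionTree t
  × AllLeafEdges (λ e → e ≡ 0ℤ) t
  × AllNodes (λ e _ _ _ → ¬ (e ≡ 0ℤ)) t
  × AllNodes (λ e v l r → ¬ BottomData e l r → v ≡ 0) t   -- f_V = 0 at top vertices

IsPreQTree : LTree → Set
IsPreQTree t =
  PartitionTree t
  × AllLeafEdges (λ e → e ≤ 0ℤ) t
  × AllNodes (λ _ v _ _ → v ≡ 0) t

leftmostNP : LTree → Maybe LTree
leftmostNP (leaf _) = nothing
leftmostNP (node _ _ l r) =
  if nonPos (label l) then just l else (if nonPos (label r) then just r else nothing)

rightmostNP : LTree → Maybe LTree
rightmostNP (leaf _) = nothing
rightmostNP (node _ _ l r) =
  if nonPos (label r) then just r else (if nonPos (label l) then just l else nothing)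

-- PathOK c : continuing a path whose current edge is c, repeatedly taking the
-- leftmost non-positive child edge of the lower endpoint, every required
-- edge exists until a leaf is reached.
data PathOK : LTree → Set where
  atLeaf : ∀ {e} → PathOK (leaf e)
  step   : ∀ {t c} → leftmostNP t ≡ just c → PathOK c → PathOK t

-- special vertex: bottom, positive parent edge, both child edges non-positive;
-- its special path starts with the left child edge
data SpecialStart : LTree → LTree → Set where
  special : ∀ {e v l r} → BottomData e l r → e > 0ℤ →
            label l ≤ 0ℤ → label r ≤ 0ℤ → SpecialStart (node e v l r) l

PathsWellDefined : LTree → Set
PathsWellDefined t =
  (∀ v → v ≼ t → Bottom v → Σ[ c ∈ LTree ] (rightmostNP v ≡ just c × PathOK c))
  × (baseLength t ≤ 0ℤ → PathOK t)
  × (∀ v c → v ≼ t → SpecialStart v c → PathOK c)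

-- A path only ever descends along non-positive edges, so it suffices that
-- below every non-positive edge at least one child edge is non-positive.
-- If both children of such an edge were positive, the vertex would be a top
-- vertex, hence f_V = 0 in an H-tree as in a pre-Q-tree, while the flow
-- equation forces f_V ≥ 1 + 1 + 0 + 1.  A bottom vertex has a non-positive
-- child by definition, and so does the vertex of a special path.
module Submission where

open import Defs
open import Data.Nat using (z≤n)
open import Data.Nat.Properties using (n≮0)
open import Data.Integer using (+_; _+_; _-_; _≤_; _<_; _>_; _≤?_; 0ℤ; 1ℤ; +≤+)
open import Data.Integer.Properties using (+-mono-<; +-mono-<-≤; neg-mono-≤; <-irrefl; ≰⇒>; <⇒≱)
open import Data.Maybe using (just)
open import Data.Product using (Σ-syntax; _×_; _,_)
open import Data.Sum using (_⊎_; inj₁; inj₂; [_,_]′)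
open import Data.Empty using (⊥; ⊥-elim)
open import Relation.Nullary using (¬_; yes; no)
open import Relation.Nullary.Decidable using (dec-false)
open import Relation.Binary.PropositionalEquality using (_≡_; refl; subst)

nonPos⊎nonPos : ∀ x y → (x > 0ℤ → y > 0ℤ → ⊥) → x ≤ 0ℤ ⊎ y ≤ 0ℤ
nonPos⊎nonPos x y ¬both with x ≤? 0ℤ | y ≤? 0ℤ
... | yes x≤0 | _       = inj₁ x≤0
... | no _    | yes y≤0 = inj₂ y≤0
... | no x≰0  | no y≰0  = ⊥-elim (¬both (≰⇒> x≰0) (≰⇒> y≰0))

flow-pos : ∀ {e l r} → e ≤ 0ℤ → l > 0ℤ → r > 0ℤ → 0ℤ < l + r - e + 1ℤ
flow-pos e≤0 l>0 r>0 =
  +-mono-<-≤ (+-mono-<-≤ (+-mono-< l>0 r>0) (neg-mono-≤ e≤0)) (+≤+ z≤n)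

zero-flow⇒nonPos-child : ∀ {e l r} → 0ℤ ≡ l + r - e + 1ℤ → e ≤ 0ℤ →
                         l ≤ 0ℤ ⊎ r ≤ 0ℤ
zero-flow⇒nonPos-child {l = l} {r} flow e≤0 =
  nonPos⊎nonPos l r λ l>0 r>0 → <-irrefl flow (flow-pos e≤0 l>0 r>0)

ind-pos : ∀ {x} → x > 0ℤ → ind x ≡ 0
ind-pos {x} x>0 rewrite dec-false (x ≤? 0ℤ) (<⇒≱ x>0) = refl

both-pos⇒¬bottom : ∀ {e l r} → label l > 0ℤ → label r > 0ℤ → ¬ BottomData e l r
both-pos⇒¬bottom {e} l>0 r>0 bottom
  rewrite ind-pos l>0 | ind-pos r>0 = n≮0 {ind e} bottom

bottom⇒nonPos-child : ∀ {e l r} → BottomData e l r → label l ≤ 0ℤ ⊎ label r ≤ 0ℤ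
bottom⇒nonPos-child {e} {l} {r} bottom =
  nonPos⊎nonPos (label l) (label r) λ l>0 r>0 →
    both-pos⇒¬bottom {e} {l} {r} l>0 r>0 bottom

NonPosDescends : LTree → Set
NonPosDescends = AllNodes (λ e _ l r → e ≤ 0ℤ → label l ≤ 0ℤ ⊎ label r ≤ 0ℤ)

hTree⇒nonPosDescends : ∀ t → IsHTree t → NonPosDescends t
hTree⇒nonPosDescends (leaf _) _ = _
hTree⇒nonPosDescends (node e v l r)
  ((flow , flowₗ , flowᵣ) , (zeroₗ , zeroᵣ) , (_ , nzₗ , nzᵣ) , (top , topₗ , topᵣ)) =
  descends ,
  hTree⇒nonPosDescends l (flowₗ , zeroₗ , nzₗ , topₗ) ,
  hTree⇒nonPosDescends r (flowᵣ , zeroᵣ , nzᵣ , topᵣ)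
  where
  descends : e ≤ 0ℤ → label l ≤ 0ℤ ⊎ label r ≤ 0ℤ
  descends e≤0 = nonPos⊎nonPos (label l) (label r) λ l>0 r>0 →
    let v≡0 = top (both-pos⇒¬bottom {e} {l} {r} l>0 r>0)
    in <-irrefl (subst (λ w → + w ≡ _) v≡0 flow) (flow-pos e≤0 l>0 r>0)

preQTree⇒nonPosDescends : ∀ t → IsPreQTree t → NonPosDescends t
preQTree⇒nonPosDescends (leaf _) _ = _
preQTree⇒nonPosDescends (node e v l r)
  ((flow , flowₗ , flowᵣ) , (nonPosₗ , nonPosᵣ) , (refl , zeroₗ , zeroᵣ)) =
  zero-flow⇒nonPos-child flow ,
  preQTree⇒nonPosDescends l (flowₗ , nonPosₗ , zeroₗ) ,
  preQTree⇒nonPosDescends r (flowᵣ , nonPosᵣ , zeroᵣ)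

AllNodes-≼ : ∀ {Q s t} → s ≼ t → AllNodes Q t → AllNodes Q s
AllNodes-≼ here      all             = all
AllNodes-≼ (inL s≼l) (_ , allₗ , _)  = AllNodes-≼ s≼l allₗ
AllNodes-≼ (inR s≼r) (_ , _ , allᵣ)  = AllNodes-≼ s≼r allᵣ

leftmostNP-just : ∀ {e v l r} (P : LTree → Set) →
                  (label l ≤ 0ℤ → P l) → (label r ≤ 0ℤ → P r) →
                  label l ≤ 0ℤ ⊎ label r ≤ 0ℤ →
                  Σ[ c ∈ LTree ] (leftmostNP (node e v l r) ≡ just c × P c)
leftmostNP-just {l = l} {r} P Pl Pr nonPos-child
  with label l ≤? 0ℤ | label r ≤? 0ℤ | nonPos-child
... | yes l≤0 | _       | _          = l , refl , Pl l≤0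
... | no _    | yes r≤0 | _          = r , refl , Pr r≤0
... | no l≰0  | no _    | inj₁ l≤0   = ⊥-elim (l≰0 l≤0)
... | no _    | no r≰0  | inj₂ r≤0   = ⊥-elim (r≰0 r≤0)

rightmostNP-just : ∀ {e v l r} (P : LTree → Set) →
                   (label l ≤ 0ℤ → P l) → (label r ≤ 0ℤ → P r) →
                   label l ≤ 0ℤ ⊎ label r ≤ 0ℤ →
                   Σ[ c ∈ LTree ] (rightmostNP (node e v l r) ≡ just c × P c)
rightmostNP-just {l = l} {r} P Pl Pr nonPos-child
  with label r ≤? 0ℤ | label l ≤? 0ℤ | nonPos-child
... | yes r≤0 | _       | _          = r , refl , Pr r≤0
... | no _    | yes l≤0 | _          = l , refl , Pl l≤0
... | no _    | no l≰0  | inj₁ l≤0   = ⊥-elim (l≰0 l≤0)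
... | no r≰0  | no _    | inj₂ r≤0   = ⊥-elim (r≰0 r≤0)

pathOK : ∀ t → NonPosDescends t → label t ≤ 0ℤ → PathOK t
pathOK (leaf _) _ _ = atLeaf
pathOK (node e v l r) (descends , descendsₗ , descendsᵣ) e≤0
  with leftmostNP-just {e} {v} PathOK (pathOK l descendsₗ) (pathOK r descendsᵣ)
                       (descends e≤0)
... | c , leftmost≡c , pathOK-c = step leftmost≡c pathOK-c

nonPosDescends⇒pathsWellDefined : ∀ t → NonPosDescends t → PathsWellDefined t
nonPosDescends⇒pathsWellDefined t descends = regularPaths , pathOK t descends , specialPaths
  where
  regularPaths : ∀ s → s ≼ t → Bottom s → Σ[ c ∈ LTree ] (rightmostNP s ≡ just c × PathOK c)
  regularPaths (leaf _) _ ()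
  regularPaths (node e v l r) s≼t bottom
    with AllNodes-≼ s≼t descends
  ... | _ , descendsₗ , descendsᵣ =
    rightmostNP-just {e} {v} PathOK (pathOK l descendsₗ) (pathOK r descendsᵣ)
                     (bottom⇒nonPos-child {e} {l} {r} bottom)
  specialPaths : ∀ s c → s ≼ t → SpecialStart s c → PathOK c
  specialPaths (node _ _ l _) .l s≼t (special _ _ l≤0 _)
    with AllNodes-≼ s≼t descends
  ... | _ , descendsₗ , _ = pathOK l descendsₗ l≤0

lemma4p2 : (t : LTree) → IsHTree t ⊎ IsPreQTree t → PathsWellDefined t
lemma4p2 t tree = nonPosDescends⇒pathsWellDefined t
  ([ hTree⇒nonPosDescends t , preQTree⇒nonPosDescends t ]′ tree)
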